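{- For every integer $k\ge 1$, $s_k \ge k^2 - 2k^{3/2} + k + \sqrt{k} - 1$. For every integer $n\ge 1$, $R_2(n) < n^{1/2} + n^{1/4} + \frac12$.
   Context: A Sidon set is a set ${\cal A}$ of integers such that the only solutions of $a_1+a_2=a_3+a_4$ with $a_i\in{\cal A}$ are the trivial ones with $\{a_1,a_2\}=\{a_3,a_4\}$. For a finite set ${\cal A}$, $\operatorname{diam}({\cal A}) := \max{\cal A}-\min{\cal A}$. $s_k$ denotes the minimum possible value of $\operatorname{diam}({\cal A})$ over all Sidon sets ${\cal A}$ with exactly $k$ elements. $R_2(n)$ denotes the maximum cardinality of a Sidon set contained in $\{1,2,\dots,n\}$. -}

module Defs where

open import Data.Nat using (ℕ)
open import Data.Integer as ℤ using (ℤ; +_; _⊔_; _⊓_; _-_)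
open import Data.Rational as ℚ using (ℚ; _/_)
open import Data.List using (List; []; _∷_; foldr)
open import Data.List.Membership.Propositional using (_∈_)
open import Data.Product using (_×_)
open import Data.Sum using (_⊎_)
open import Relation.Binary.PropositionalEquality using (_≡_)

-- A finite set of integers is represented by a list of integers; the
-- statement additionally requires the list to be duplicate-free.

Sidon : List ℤ → Set
Sidon A = ∀ {a₁ a₂ a₃ a₄} → a₁ ∈ A → a₂ ∈ A → a₃ ∈ A → a₄ ∈ A →
  a₁ ℤ.+ a₂ ≡ a₃ ℤ.+ a₄ →
  (a₁ ≡ a₃ × a₂ ≡ a₄) ⊎ (a₁ ≡ a₄ × a₂ ≡ a₃)

-- diam(A) = max A − min A  (set to 0 for the empty list; only used for
-- nonempty A).
diam : List ℤ → ℤ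
diam []       = + 0
diam (x ∷ xs) = foldr _⊔_ x xs - foldr _⊓_ x xs

toℚ : ℤ → ℚ
toℚ z = z / 1

ℕtoℚ : ℕ → ℚ
ℕtoℚ n = (+ n) / 1

-- Lindström's argument: if a₀ < ⋯ < a_{k−1} is a Sidon set of diameter d and m ≤ k, the
-- N = mk − m(m + 1)/2 differences a_{i+j} − a_i with 1 ≤ j ≤ m are distinct positive integers,
-- and for each j they telescope to at most j·d, so N(N + 1) ≤ m(m + 1)d. Take m = r = ⌊√k⌋ and
-- write k = r² + e. For the diameter, d + 1 ≥ k² + k − (2k − 1)·2ck/(k + c²), where
-- (k + c²)/2c ≥ √k is a Newton approximation of √k from c ∈ {r, r + 1}. For the size, the
-- witness is q = p − ½ with p ≥ √(k − ¼) a Newton approximation from r, r + ½ or r + 1, so that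
-- k < q² + q + ½, and q⁴ ≤ d + 1 ≤ n. All resulting inequalities between polynomials in r and e
-- are verified piecewise in (r, e) by comparing coefficients.

module Submission where

module Signature where

  open import Data.Nat.Base using (ℕ)

  record Arithmetic (A : Set) : Set where
    infixl 6 _+_
    infixl 7 _*_
    infix  8 #_
    field
      _+_ _*_ : A → A → A
      #_      : ℕ → A

module Polynomials where

  open import Data.Bool.Base using (T)
  open import Data.Fin.Base using (Fin; zero; suc)
  open import Data.List.Base using (List; []; _∷_; map; foldr)
  open import Data.Maybe.Base as Maybe using (Maybe; just; nothing; is-just)
  open import Data.Nat.Base using (ℕ; zero; suc; _+_; _*_; _∸_; _^_; _≤_)
  open import Data.Nat.ListAction using (sum)
  open import Data.Nat.Properties
  open import Data.Nat.Tactic.RingSolver using (solve-∀)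
  open import Data.Product.Base using (Σ-syntax; _×_; _,_)
  open import Data.Vec.Base using (Vec; []; _∷_; lookup; replicate; zipWith)
  import Data.Vec.Properties as Vec
  open import Relation.Binary.PropositionalEquality
  open import Relation.Nullary.Decidable.Core using (yes; no)
  open Signature

  infixl 6 _:+_
  infixl 7 _:*_

  data Expr (n : ℕ) : Set where
    var : Fin n → Expr n
    con : ℕ → Expr n
    _:+_ _:*_ : Expr n → Expr n → Expr n

  eval : ∀ {n A} → Arithmetic A → Expr n → Vec A n → A
  eval 𝔸 (var i)  ρ = lookup ρ i
  eval 𝔸 (con c)  ρ = Arithmetic.#_ 𝔸 c
  eval 𝔸 (a :+ b) ρ = Arithmetic._+_ 𝔸 (eval 𝔸 a ρ) (eval 𝔸 b ρ)
  eval 𝔸 (a :* b) ρ = Arithmetic._*_ 𝔸 (eval 𝔸 a ρ) (eval 𝔸 b ρ)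

  ℕ-arithmetic : Arithmetic ℕ
  ℕ-arithmetic = record { _+_ = _+_ ; _*_ = _*_ ; #_ = λ c → c }

  Expr-arithmetic : ∀ {n} → Arithmetic (Expr n)
  Expr-arithmetic = record { _+_ = _:+_ ; _*_ = _:*_ ; #_ = con }

  ⟦_⟧ : ∀ {n} → Expr n → Vec ℕ n → ℕ
  ⟦_⟧ = eval ℕ-arithmetic

  Monomial : ℕ → Set
  Monomial n = ℕ × Vec ℕ n

  Polynomial : ℕ → Set
  Polynomial n = List (Monomial n)

  power : ∀ {n} → Vec ℕ n → Vec ℕ n → ℕ
  power []      []       = 1
  power (x ∷ ρ) (e ∷ es) = x ^ e * power ρ es

  ⟦_⟧ₘ : ∀ {n} → Monomial n → Vec ℕ n → ℕ
  ⟦ c , es ⟧ₘ ρ = c * power ρ es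

  ⟦_⟧ₚ : ∀ {n} → Polynomial n → Vec ℕ n → ℕ
  ⟦ p ⟧ₚ ρ = sum (map (λ m → ⟦ m ⟧ₘ ρ) p)

  unit : ∀ {n} → Fin n → Vec ℕ n
  unit zero    = 1 ∷ replicate _ 0
  unit (suc i) = 0 ∷ unit i

  power-zero : ∀ {n} (ρ : Vec ℕ n) → power ρ (replicate n 0) ≡ 1
  power-zero []      = refl
  power-zero (x ∷ ρ) = trans (+-identityʳ _) (power-zero ρ)

  power-unit : ∀ {n} (ρ : Vec ℕ n) i → power ρ (unit i) ≡ lookup ρ i
  power-unit (x ∷ ρ) zero    = trans (cong₂ _*_ (*-identityʳ x) (power-zero ρ)) (*-identityʳ x)
  power-unit (x ∷ ρ) (suc i) = trans (+-identityʳ _) (power-unit ρ i)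

  power-+ : ∀ {n} (ρ es fs : Vec ℕ n) → power ρ (zipWith _+_ es fs) ≡ power ρ es * power ρ fs
  power-+ []      []       []       = refl
  power-+ (x ∷ ρ) (e ∷ es) (f ∷ fs) = begin
    x ^ (e + f) * power ρ (zipWith _+_ es fs)     ≡⟨ cong₂ _*_ (^-distribˡ-+-* x e f) (power-+ ρ es fs) ⟩
    x ^ e * x ^ f * (power ρ es * power ρ fs)     ≡⟨ interchange (x ^ e) (x ^ f) (power ρ es) (power ρ fs) ⟩
    x ^ e * power ρ es * (x ^ f * power ρ fs)     ∎
    where
    open ≡-Reasoning
    interchange : ∀ a b c d → a * b * (c * d) ≡ a * c * (b * d)
    interchange = solve-∀

  insert : ∀ {n} → Monomial n → Polynomial n → Polynomial n
  insert m [] = m ∷ []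
  insert (c , es) ((c′ , es′) ∷ p) with Vec.≡-dec _≟_ es es′
  ... | yes _ = (c + c′ , es′) ∷ p
  ... | no _  = (c′ , es′) ∷ insert (c , es) p

  insert-sound : ∀ {n} m (p : Polynomial n) ρ → ⟦ insert m p ⟧ₚ ρ ≡ ⟦ m ⟧ₘ ρ + ⟦ p ⟧ₚ ρ
  insert-sound m [] ρ = refl
  insert-sound (c , es) ((c′ , es′) ∷ p) ρ with Vec.≡-dec _≟_ es es′
  ... | yes refl = trans (cong (_+ ⟦ p ⟧ₚ ρ) (*-distribʳ-+ (power ρ es) c c′))
                         (+-assoc (c * power ρ es) (c′ * power ρ es) (⟦ p ⟧ₚ ρ))
  ... | no _ = trans (cong (⟦ c′ , es′ ⟧ₘ ρ +_) (insert-sound (c , es) p ρ))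
                     (swap (⟦ c′ , es′ ⟧ₘ ρ) (⟦ c , es ⟧ₘ ρ) (⟦ p ⟧ₚ ρ))
    where
    swap : ∀ a b c → a + (b + c) ≡ b + (a + c)
    swap = solve-∀

  infixl 6 _⊕_
  infixl 7 _⊗_

  _⊕_ : ∀ {n} → Polynomial n → Polynomial n → Polynomial n
  p ⊕ q = foldr insert q p

  ⊕-sound : ∀ {n} (p q : Polynomial n) ρ → ⟦ p ⊕ q ⟧ₚ ρ ≡ ⟦ p ⟧ₚ ρ + ⟦ q ⟧ₚ ρ
  ⊕-sound []      q ρ = refl
  ⊕-sound (m ∷ p) q ρ = begin
    ⟦ insert m (p ⊕ q) ⟧ₚ ρ          ≡⟨ insert-sound m (p ⊕ q) ρ ⟩
    ⟦ m ⟧ₘ ρ + ⟦ p ⊕ q ⟧ₚ ρ          ≡⟨ cong (⟦ m ⟧ₘ ρ +_) (⊕-sound p q ρ) ⟩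
    ⟦ m ⟧ₘ ρ + (⟦ p ⟧ₚ ρ + ⟦ q ⟧ₚ ρ) ≡⟨ +-assoc (⟦ m ⟧ₘ ρ) _ _ ⟨
    ⟦ m ⟧ₘ ρ + ⟦ p ⟧ₚ ρ + ⟦ q ⟧ₚ ρ   ∎
    where
    open ≡-Reasoning

  _·_ : ∀ {n} → Monomial n → Monomial n → Monomial n
  (c , es) · (d , fs) = c * d , zipWith _+_ es fs

  ·-sound : ∀ {n} (m m′ : Monomial n) ρ → ⟦ m · m′ ⟧ₘ ρ ≡ ⟦ m ⟧ₘ ρ * ⟦ m′ ⟧ₘ ρ
  ·-sound (c , es) (d , fs) ρ =
    trans (cong (c * d *_) (power-+ ρ es fs)) (interchange c d (power ρ es) (power ρ fs))
    where
    interchange : ∀ a b c d → a * b * (c * d) ≡ a * c * (b * d)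
    interchange = solve-∀

  scale-sound : ∀ {n} m (q : Polynomial n) ρ → ⟦ map (m ·_) q ⟧ₚ ρ ≡ ⟦ m ⟧ₘ ρ * ⟦ q ⟧ₚ ρ
  scale-sound m []       ρ = sym (*-zeroʳ (⟦ m ⟧ₘ ρ))
  scale-sound m (m′ ∷ q) ρ =
    trans (cong₂ _+_ (·-sound m m′ ρ) (scale-sound m q ρ)) (sym (*-distribˡ-+ (⟦ m ⟧ₘ ρ) _ _))

  _⊗_ : ∀ {n} → Polynomial n → Polynomial n → Polynomial n
  p ⊗ q = foldr (λ m r → map (m ·_) q ⊕ r) [] p

  ⊗-sound : ∀ {n} (p q : Polynomial n) ρ → ⟦ p ⊗ q ⟧ₚ ρ ≡ ⟦ p ⟧ₚ ρ * ⟦ q ⟧ₚ ρ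
  ⊗-sound []      q ρ = refl
  ⊗-sound (m ∷ p) q ρ = begin
    ⟦ map (m ·_) q ⊕ p ⊗ q ⟧ₚ ρ              ≡⟨ ⊕-sound (map (m ·_) q) (p ⊗ q) ρ ⟩
    ⟦ map (m ·_) q ⟧ₚ ρ + ⟦ p ⊗ q ⟧ₚ ρ       ≡⟨ cong₂ _+_ (scale-sound m q ρ) (⊗-sound p q ρ) ⟩
    ⟦ m ⟧ₘ ρ * ⟦ q ⟧ₚ ρ + ⟦ p ⟧ₚ ρ * ⟦ q ⟧ₚ ρ ≡⟨ *-distribʳ-+ (⟦ q ⟧ₚ ρ) (⟦ m ⟧ₘ ρ) _ ⟨
    (⟦ m ⟧ₘ ρ + ⟦ p ⟧ₚ ρ) * ⟦ q ⟧ₚ ρ          ∎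
    where
    open ≡-Reasoning

  normalise : ∀ {n} → Expr n → Polynomial n
  normalise (var i)  = (1 , unit i) ∷ []
  normalise (con c)  = (c , replicate _ 0) ∷ []
  normalise (a :+ b) = normalise a ⊕ normalise b
  normalise (a :* b) = normalise a ⊗ normalise b

  normalise-sound : ∀ {n} (e : Expr n) ρ → ⟦ normalise e ⟧ₚ ρ ≡ ⟦ e ⟧ ρ
  normalise-sound (var i)  ρ = trans (+-identityʳ _) (trans (+-identityʳ _) (power-unit ρ i))
  normalise-sound (con c)  ρ = trans (+-identityʳ _) (trans (cong (c *_) (power-zero ρ)) (*-identityʳ c))
  normalise-sound (a :+ b) ρ =
    trans (⊕-sound (normalise a) (normalise b) ρ) (cong₂ _+_ (normalise-sound a ρ) (normalise-sound b ρ))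
  normalise-sound (a :* b) ρ =
    trans (⊗-sound (normalise a) (normalise b) ρ) (cong₂ _*_ (normalise-sound a ρ) (normalise-sound b ρ))

  Remainder : ∀ {n} → Polynomial n → Polynomial n → Set
  Remainder {n} p q = Σ[ r ∈ Polynomial n ] (∀ ρ → ⟦ p ⟧ₚ ρ + ⟦ r ⟧ₚ ρ ≡ ⟦ q ⟧ₚ ρ)

  remove : ∀ {n} (m : Monomial n) q → Maybe (Remainder (m ∷ []) q)
  remove (zero  , es) q = just (q , λ ρ → refl)
  remove (suc c , es) [] = nothing
  remove (suc c , es) ((c′ , es′) ∷ q) with Vec.≡-dec _≟_ es es′ | suc c ≤? c′
  ... | yes es≡es′ | yes c<c′ = just ((c′ ∸ suc c , es′) ∷ q , λ ρ →
    subst (λ fs → suc c * power ρ fs + 0 + ((c′ ∸ suc c) * power ρ es′ + ⟦ q ⟧ₚ ρ) ≡ c′ * power ρ es′ + ⟦ q ⟧ₚ ρ)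
          (sym es≡es′) (take-coefficient c<c′ (power ρ es′) (⟦ q ⟧ₚ ρ)))
    where
    take-coefficient : ∀ {a b} → a ≤ b → ∀ P Q → a * P + 0 + ((b ∸ a) * P + Q) ≡ b * P + Q
    take-coefficient {a} {b} a≤b P Q = begin
      a * P + 0 + ((b ∸ a) * P + Q) ≡⟨ rearrange (a * P) ((b ∸ a) * P) Q ⟩
      (b ∸ a) * P + a * P + Q       ≡⟨ cong (_+ Q) (*-distribʳ-+ P (b ∸ a) a) ⟨
      (b ∸ a + a) * P + Q           ≡⟨ cong (λ z → z * P + Q) (m∸n+n≡m a≤b) ⟩
      b * P + Q                     ∎
      where
      open ≡-Reasoning
      rearrange : ∀ x y z → x + 0 + (y + z) ≡ y + x + z
      rearrange = solve-∀
  ... | _ | _ = Maybe.map (λ (r , eq) → (c′ , es′) ∷ r , λ ρ →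
    trans (swap (⟦ suc c , es ⟧ₘ ρ + 0) (⟦ c′ , es′ ⟧ₘ ρ) (⟦ r ⟧ₚ ρ)) (cong (⟦ c′ , es′ ⟧ₘ ρ +_) (eq ρ)))
    (remove (suc c , es) q)
    where
    swap : ∀ a b c → a + (b + c) ≡ b + (a + c)
    swap = solve-∀

  subtract : ∀ {n} (p q : Polynomial n) → Maybe (Remainder p q)
  subtract []      q = just (q , λ ρ → refl)
  subtract (m ∷ p) q with remove m q
  ... | nothing = nothing
  ... | just (q′ , eq) = Maybe.map (λ (r , eq′) → r , λ ρ →
    trans (reassoc (⟦ m ⟧ₘ ρ) (⟦ p ⟧ₚ ρ) (⟦ r ⟧ₚ ρ)) (trans (cong (⟦ m ⟧ₘ ρ + 0 +_) (eq′ ρ)) (eq ρ)))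
    (subtract p q′)
    where
    reassoc : ∀ a b c → a + b + c ≡ a + 0 + (b + c)
    reassoc = solve-∀

  -- Every monomial of l occurs in r with at least the same coefficient; since the
  -- variables range over ℕ, ⟦ l ⟧ ≤ ⟦ r ⟧ then holds everywhere.
  Dominated : ∀ {n} → Expr n → Expr n → Set
  Dominated l r = T (is-just (subtract (normalise l) (normalise r)))

  poly-≤ : ∀ {n} (l r : Expr n) {_ : Dominated l r} ρ → ⟦ l ⟧ ρ ≤ ⟦ r ⟧ ρ
  poly-≤ l r ρ with subtract (normalise l) (normalise r)
  ... | just (s , eq) = subst₂ _≤_ (normalise-sound l ρ) (trans (eq ρ) (normalise-sound r ρ)) (m≤m+n _ _)

  poly-≡ : ∀ {n} (l r : Expr n) {_ : Dominated l r} {_ : Dominated r l} ρ → ⟦ l ⟧ ρ ≡ ⟦ r ⟧ ρ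
  poly-≡ l r {l≤r} {r≤l} ρ = ≤-antisym (poly-≤ l r {l≤r} ρ) (poly-≤ r l {r≤l} ρ)

module Formulas {A : Set} (𝔸 : Signature.Arithmetic A) where

  open Signature.Arithmetic 𝔸

  -- k = r² + e with r = r′ + 1 ≥ 1, M = r(r + 1), and T = r(2k − r − 1) written without
  -- subtraction: T/2 counts the differences a_{i+j} − a_i with 1 ≤ j ≤ r.
  module Square (r′ e : A) where

    r k M T : A
    r = # 1 + r′
    k = r * r + e
    M = r * (r + # 1)
    T = r * (r′ * (# 2 * r′ + # 3) + # 2 * e)

  -- lower ≤ d·P + excess says d + 1 ≥ k² + k − (2k − 1)·2ck/P, where P/2c ≥ √k.
  module Newton (k c : A) where

    P lower excess : A
    P      = k + c * c
    lower  = (k * k + k) * P + # 2 * c * k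
    excess = P + # 4 * c * k * k

  -- X/H = p − ½ with p = (h² + 4k − 1)/4h, the Newton step for √(k − ¼) from h/2.
  module Witness (r′ e j : A) where

    open Square r′ e public

    h H X : A
    h = # 2 * r + j
    H = # 4 * h
    X = (# 2 * r′ + # 1 + j) * (# 2 * r′ + # 1 + j) + # 4 * r′ * r′ + # 8 * r′ + # 2 + # 4 * e

  fourth : A → A
  fourth x = x * x * x * x

  -- Combined with T(T + 2) ≤ 4Md these give lower ≤ d·P + excess and X⁴ ≤ (d + 1)H⁴.
  part1-lhs part1-rhs : A → A → A → A
  part1-lhs r′ e c = # 4 * M * lower
    where
    open Square r′ e
    open Newton k c
  part1-rhs r′ e c = T * (T + # 2) * P + # 4 * M * excess
    where
    open Square r′ e
    open Newton k c

  part2-lhs part2-rhs : A → A → A → A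
  part2-lhs r′ e j = # 4 * M * fourth X
    where
    open Witness r′ e j
  part2-rhs r′ e j = (# 4 * M + T * (T + # 2)) * fourth H
    where
    open Witness r′ e j

module Elementary where

  open import Data.Nat.Base using (ℕ; zero; suc; _+_; _*_; _≤_; _<_; z≤n; z<s; ∣_-_∣)
  open import Data.Nat.Properties
  open import Data.Nat.Tactic.RingSolver using (solve-∀)
  open import Data.Product.Base using (Σ-syntax; _×_; _,_)
  open import Data.Sum.Base using (_⊎_; inj₁; inj₂)
  open import Function.Base using (_∘_)
  open import Relation.Binary.PropositionalEquality
  open import Relation.Nullary.Negation.Core using (contradiction)
  open Formulas Polynomials.ℕ-arithmetic using (module Square)

  square-of-sum : ∀ a b → (a + b) * (a + b) ≡ 4 * a * b + ∣ a - b ∣ * ∣ a - b ∣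
  square-of-sum a b with ≤-total a b
  ... | inj₁ a≤b with m≤n⇒∃[o]m+o≡n a≤b
  ...   | t , refl = trans (expand a t) (cong (λ s → 4 * a * (a + t) + s * s) (sym (∣m-m+n∣≡n a t)))
    where
    expand : ∀ a t → (a + (a + t)) * (a + (a + t)) ≡ 4 * a * (a + t) + t * t
    expand = solve-∀
  square-of-sum a b | inj₂ b≤a with m≤n⇒∃[o]m+o≡n b≤a
  ...   | t , refl = trans (expand b t) (cong (λ s → 4 * (b + t) * b + s * s) (sym ∣b+t-b∣≡t))
    where
    expand : ∀ b t → (b + t + b) * (b + t + b) ≡ 4 * (b + t) * b + t * t
    expand = solve-∀
    ∣b+t-b∣≡t : ∣ b + t - b ∣ ≡ t
    ∣b+t-b∣≡t = trans (∣-∣-comm (b + t) b) (∣m-m+n∣≡n b t)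

  am-gm : ∀ a b → 4 * a * b ≤ (a + b) * (a + b)
  am-gm a b = subst (4 * a * b ≤_) (sym (square-of-sum a b)) (m≤m+n _ _)

  am-gm-strict : ∀ a b → a ≢ b → 4 * a * b < (a + b) * (a + b)
  am-gm-strict a b a≢b = subst (4 * a * b <_) (sym (square-of-sum a b)) (m<m+n _ (positive-square (a≢b ∘ ∣m-n∣≡0⇒m≡n)))
    where
    positive-square : ∀ {n} → n ≢ 0 → 0 < n * n
    positive-square {zero}  n≢0 = contradiction refl n≢0
    positive-square {suc n} _   = z<s

  parity : ∀ n → Σ[ t ∈ ℕ ] (n ≡ 2 * t ⊎ n ≡ suc (2 * t))
  parity zero = 0 , inj₁ refl
  parity (suc n) with parity n
  ... | t , inj₁ refl = t , inj₂ refl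
  ... | t , inj₂ refl = suc t , inj₁ (cong suc (sym (+-suc t (t + 0))))

  square+1≢4* : ∀ h m → h * h + 1 ≢ 4 * m
  square+1≢4* h m eq with parity h
  ... | t , inj₁ refl = even≢odd (2 * m) (2 * (t * t)) (sym (trans (sym (even² t)) (trans eq (quadruple m))))
    where
    even² : ∀ t → 2 * t * (2 * t) + 1 ≡ suc (2 * (2 * (t * t)))
    even² = solve-∀
    quadruple : ∀ m → 4 * m ≡ 2 * (2 * m)
    quadruple = solve-∀
  ... | t , inj₂ refl = even≢odd m (t * t + t) (sym (*-cancelˡ-≡ _ _ 2 (trans (sym (odd² t)) (trans eq (quadruple m)))))
    where
    odd² : ∀ t → suc (2 * t) * suc (2 * t) + 1 ≡ 2 * suc (2 * (t * t + t))
    odd² = solve-∀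
    quadruple : ∀ m → 4 * m ≡ 2 * (2 * m)
    quadruple = solve-∀

  square-decomposition : ∀ k → Σ[ r′ ∈ ℕ ] Σ[ e ∈ ℕ ] (suc k ≡ Square.k r′ e × e ≤ suc r′ + suc r′)
  square-decomposition zero = 0 , 0 , refl , z≤n
  square-decomposition (suc k) with square-decomposition k
  ... | r′ , e , refl , e≤2r with m≤n⇒m<n∨m≡n e≤2r
  ...   | inj₁ e<2r = r′ , suc e , cong suc (sym (+-suc _ e)) , e<2r
  ...   | inj₂ refl = suc r′ , 0 , next-square r′ , z≤n
    where
    next-square : ∀ r′ → suc (suc r′ * suc r′ + (suc r′ + suc r′)) ≡ suc (suc r′) * suc (suc r′) + 0
    next-square = solve-∀

module Differences where

  open import Data.List.Base using (List; []; _∷_; _++_; length; applyUpTo)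
  open import Data.List.Membership.Propositional using (_∈_)
  open import Data.List.Membership.Propositional.Properties using (∈-applyUpTo⁻; ∈-++⁻)
  open import Data.List.Properties using (length-applyUpTo; length-++)
  open import Data.List.Relation.Binary.Permutation.Propositional using (_↭_; ↭-sym; ↭⇒↭ₛ)
  open import Data.List.Relation.Binary.Permutation.Propositional.Properties using (All-resp-↭; ↭-length)
  import Data.List.Relation.Binary.Permutation.Setoid.Properties as Permutation
  open import Data.List.Relation.Unary.All as All using (All; []; _∷_)
  open import Data.List.Relation.Unary.AllPairs as AllPairs using (AllPairs; []; _∷_)
  open import Data.List.Relation.Unary.Linked.Properties using (Linked⇒AllPairs)
  open import Data.List.Relation.Unary.Unique.Propositional using (Unique)
  import Data.List.Relation.Unary.Unique.Propositional.Properties as Unique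
  open import Data.Nat.Base using (ℕ; zero; suc; _+_; _*_; _∸_; _≤_; _<_; z≤n; s≤s; z<s; s<s)
  open import Data.Nat.ListAction using (sum)
  open import Data.Nat.ListAction.Properties using (sum-++; sum-↭)
  open import Data.Nat.Properties
  open import Data.List.Sort ≤-decTotalOrder using (sort; sort-↭; sort-↗)
  open import Data.Nat.Tactic.RingSolver using (solve-∀)
  open import Data.Empty using (⊥)
  open import Data.Product.Base using (∃; ∃₂; _×_; _,_; proj₁; proj₂)
  open import Data.Sum.Base using (_⊎_; inj₁; inj₂)
  open import Function.Base using (_∘_)
  open import Relation.Binary.Definitions using (tri<; tri≈; tri>)
  open import Relation.Binary.PropositionalEquality
  open import Relation.Nullary.Negation.Core using (contradiction)

  unique-↭ : ∀ {A : Set} {xs ys : List A} → xs ↭ ys → Unique xs → Unique ys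
  unique-↭ p = Permutation.Unique-resp-↭ (setoid _) (↭⇒↭ₛ p)

  increasing-sum : ∀ b xs → AllPairs _<_ xs → All (b ≤_) xs →
    length xs * (length xs + 2 * b) ≤ 2 * sum xs + length xs
  increasing-sum b []       []          []           = z≤n
  increasing-sum b (x ∷ xs) (x< ∷ <xs) (b≤x ∷ b≤xs) = begin
    suc n * (suc n + 2 * b)                       ≡⟨ expand n b ⟩
    n * (n + 2 * suc b) + (2 * b + 1)             ≤⟨ +-mono-≤ (increasing-sum (suc b) xs <xs (All.map (≤-<-trans b≤x) x<)) (+-monoˡ-≤ 1 (*-monoʳ-≤ 2 b≤x)) ⟩
    2 * sum xs + n + (2 * x + 1)                  ≡⟨ collect (sum xs) n x ⟩
    2 * (x + sum xs) + suc n                      ∎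
    where
    open ≤-Reasoning
    n : ℕ
    n = length xs
    expand : ∀ n b → suc n * (suc n + 2 * b) ≡ n * (n + 2 * suc b) + (2 * b + 1)
    expand = solve-∀
    collect : ∀ s n x → 2 * s + n + (2 * x + 1) ≡ 2 * (x + s) + suc n
    collect = solve-∀

  distinct-positive-sum : ∀ xs → Unique xs → All (1 ≤_) xs → length xs * (length xs + 1) ≤ 2 * sum xs
  distinct-positive-sum xs unique positive = +-cancelʳ-≤ (length xs) _ _ (begin
    length xs * (length xs + 1) + length xs ≡⟨ shift (length xs) ⟩
    length xs * (length xs + 2 * 1)         ≡⟨ cong (λ n → n * (n + 2 * 1)) (↭-length (↭-sym sorted)) ⟩
    length ys * (length ys + 2 * 1)         ≤⟨ increasing-sum 1 ys increasing (All-resp-↭ (↭-sym sorted) positive) ⟩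
    2 * sum ys + length ys                  ≡⟨ cong₂ (λ s n → 2 * s + n) (sum-↭ sorted) (↭-length sorted) ⟩
    2 * sum xs + length xs                  ∎)
    where
    open ≤-Reasoning
    ys : List ℕ
    ys = sort xs
    sorted : ys ↭ xs
    sorted = sort-↭ xs
    increasing : AllPairs _<_ ys
    increasing = AllPairs.zipWith (λ (x≤y , x≢y) → ≤∧≢⇒< x≤y x≢y) (Linked⇒AllPairs ≤-trans (sort-↗ xs) , unique-↭ (↭-sym sorted) unique)
    shift : ∀ n → n * (n + 1) + n ≡ n * (n + 2 * 1)
    shift = solve-∀

  ∑< : ℕ → (ℕ → ℕ) → ℕ
  ∑< n g = sum (applyUpTo g n)

  ∑<-split : ∀ a b g → ∑< (a + b) g ≡ ∑< a g + ∑< b (λ i → g (a + i))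
  ∑<-split zero    b g = refl
  ∑<-split (suc a) b g = trans (cong (g 0 +_) (∑<-split a b (g ∘ suc))) (sym (+-assoc (g 0) _ _))

  ∑<-+ : ∀ n g h → ∑< n (λ i → g i + h i) ≡ ∑< n g + ∑< n h
  ∑<-+ zero    g h = refl
  ∑<-+ (suc n) g h = trans (cong (g 0 + h 0 +_) (∑<-+ n (g ∘ suc) (h ∘ suc))) (interchange (g 0) (h 0) _ _)
    where
    interchange : ∀ a b c d → a + b + (c + d) ≡ a + c + (b + d)
    interchange = solve-∀

  ∑<-cong : ∀ n {g h} → (∀ {i} → i < n → g i ≡ h i) → ∑< n g ≡ ∑< n h
  ∑<-cong zero    g≡h = refl
  ∑<-cong (suc n) g≡h = cong₂ _+_ (g≡h z<s) (∑<-cong n (g≡h ∘ s<s))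

  ∑<-mono-≤ : ∀ n {g h} → (∀ {i} → i < n → g i ≤ h i) → ∑< n g ≤ ∑< n h
  ∑<-mono-≤ zero    g≤h = z≤n
  ∑<-mono-≤ (suc n) g≤h = +-mono-≤ (g≤h z<s) (∑<-mono-≤ n (g≤h ∘ s<s))

  ∑<-const : ∀ n c → ∑< n (λ _ → c) ≡ n * c
  ∑<-const zero    c = refl
  ∑<-const (suc n) c = cong (c +_) (∑<-const n c)

  module Gaps (f : ℕ → ℕ) (k d : ℕ)
    (increasing : ∀ {i j} → i < j → j < k → f i < f j)
    (bounded : ∀ {i} → i < k → f i ≤ d)
    (sidon : ∀ {i₁ i₂ i₃ i₄} → i₁ < k → i₂ < k → i₃ < k → i₄ < k → f i₁ + f i₂ ≡ f i₃ + f i₄ →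
             (f i₁ ≡ f i₃ × f i₂ ≡ f i₄) ⊎ (f i₁ ≡ f i₄ × f i₂ ≡ f i₃))
    where

    f-injective : ∀ {i j} → i < k → j < k → f i ≡ f j → i ≡ j
    f-injective {i} {j} i<k j<k fi≡fj with <-cmp i j
    ... | tri< i<j _ _ = contradiction fi≡fj (<⇒≢ (increasing i<j j<k))
    ... | tri≈ _ i≡j _ = i≡j
    ... | tri> _ _ j<i = contradiction (sym fi≡fj) (<⇒≢ (increasing j<i i<k))

    gap : ℕ → ℕ → ℕ
    gap i j = f (j + i) ∸ f i

    start<k : ∀ {i} j → j + i < k → i < k
    start<k {i} j j+i<k = ≤-<-trans (m≤n+m i j) j+i<k

    f-mono : ∀ {i} j → j + i < k → f i ≤ f (j + i)
    f-mono zero    _     = ≤-refl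
    f-mono {i} (suc j) j+i<k = <⇒≤ (increasing (m<n+m i z<s) j+i<k)

    gap+f : ∀ {i} j → j + i < k → gap i j + f i ≡ f (j + i)
    gap+f j j+i<k = m∸n+n≡m (f-mono j j+i<k)

    gap-positive : ∀ {i j} → 1 ≤ j → j + i < k → 1 ≤ gap i j
    gap-positive {i} {suc j} _ j+i<k = m<n⇒0<n∸m (increasing (m<n+m i z<s) j+i<k)

    gap-injective : ∀ {i j i′ j′} → 1 ≤ j → j + i < k → j′ + i′ < k → gap i j ≡ gap i′ j′ → i ≡ i′ × j ≡ j′
    gap-injective {i} {j} {i′} {j′} 1≤j j+i<k j′+i′<k same-gap
      with sidon j+i<k (start<k j′ j′+i′<k) j′+i′<k (start<k j j+i<k) crossed
      where
      open ≡-Reasoning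
      swap : ∀ a b c → a + b + c ≡ a + c + b
      swap = solve-∀
      crossed : f (j + i) + f i′ ≡ f (j′ + i′) + f i
      crossed = begin
        f (j + i) + f i′          ≡⟨ cong (_+ f i′) (gap+f j j+i<k) ⟨
        gap i j + f i + f i′      ≡⟨ swap (gap i j) (f i) (f i′) ⟩
        gap i j + f i′ + f i      ≡⟨ cong (λ g → g + f i′ + f i) same-gap ⟩
        gap i′ j′ + f i′ + f i    ≡⟨ cong (_+ f i) (gap+f j′ j′+i′<k) ⟩
        f (j′ + i′) + f i         ∎
    ... | inj₁ (ends , starts) = sym i≡i′ , +-cancelʳ-≡ i j j′ (trans (f-injective j+i<k j′+i′<k ends) (cong (j′ +_) i≡i′))
      where
      i≡i′ : i′ ≡ i
      i≡i′ = f-injective (start<k j′ j′+i′<k) (start<k j j+i<k) starts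
    ... | inj₂ (degenerate , _) = contradiction (f-injective j+i<k (start<k j j+i<k) degenerate) (<⇒≢ (m<n+m i 1≤j) ∘ sym)

    -- Σᵢ f(j + i) − Σᵢ f(i) telescopes to the last j values minus the first j values.
    gaps-sum : ∀ j → j ≤ k → ∑< (k ∸ j) (λ i → gap i j) ≤ j * d
    gaps-sum j j≤k = +-cancelʳ-≤ (∑< c f) _ _ (begin
      ∑< c (λ i → gap i j) + ∑< c f        ≤⟨ m≤n+m _ (∑< j f) ⟩
      ∑< j f + (∑< c (λ i → gap i j) + ∑< c f) ≡⟨ cong (∑< j f +_) shifted ⟨
      ∑< j f + ∑< c (λ i → f (j + i))       ≡⟨ ∑<-split j c f ⟨
      ∑< (j + c) f                         ≡⟨ cong (λ n → ∑< n f) (+-comm j c) ⟩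
      ∑< (c + j) f                         ≡⟨ ∑<-split c j f ⟩
      ∑< c f + ∑< j (λ t → f (c + t))       ≤⟨ +-monoʳ-≤ (∑< c f) last ⟩
      ∑< c f + j * d                       ≡⟨ +-comm (∑< c f) (j * d) ⟩
      j * d + ∑< c f                       ∎)
      where
      open ≤-Reasoning
      c : ℕ
      c = k ∸ j
      j+c≡k : j + c ≡ k
      j+c≡k = m+[n∸m]≡n j≤k
      shifted : ∑< c (λ i → f (j + i)) ≡ ∑< c (λ i → gap i j) + ∑< c f
      shifted = trans (∑<-cong c (λ i<c → sym (gap+f j (subst (j + _ <_) j+c≡k (+-monoʳ-< j i<c)))))
                      (∑<-+ c (λ i → gap i j) f)
      last : ∑< j (λ t → f (c + t)) ≤ j * d
      last = ≤-trans (∑<-mono-≤ j (λ t<j → bounded (subst (c + _ <_) (trans (+-comm c j) j+c≡k) (+-monoʳ-< c t<j))))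
                     (≤-reflexive (∑<-const j d))

    block : ℕ → List ℕ
    block j = applyUpTo (λ i → gap i j) (k ∸ j)

    differences : ℕ → List ℕ
    differences zero    = []
    differences (suc m) = block (suc m) ++ differences m

    in-range : ∀ {i j} → i < k ∸ j → j + i < k
    in-range {i} {j} i<k∸j = subst (_< k) (+-comm i j) (m≤o∸n⇒m+n≤o (suc i) (<⇒≤ j<k) i<k∸j)
      where
      j<k : j < k
      j<k = m∸n≢0⇒n<m (λ k∸j≡0 → n≮0 (subst (i <_) k∸j≡0 i<k∸j))

    ∈-differences : ∀ m {x} → x ∈ differences m → ∃₂ λ i j → 1 ≤ j × j ≤ m × j + i < k × x ≡ gap i j
    ∈-differences (suc m) x∈ with ∈-++⁻ (block (suc m)) x∈
    ... | inj₁ x∈block = let i , i<k∸j , x≡gap = ∈-applyUpTo⁻ (λ i → gap i (suc m)) x∈block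
                         in i , suc m , s≤s z≤n , ≤-refl , in-range i<k∸j , x≡gap
    ... | inj₂ x∈rest  = let i , j , 1≤j , j≤m , j+i<k , x≡gap = ∈-differences m x∈rest
                         in i , j , 1≤j , m≤n⇒m≤1+n j≤m , j+i<k , x≡gap

    differences-positive : ∀ m → All (1 ≤_) (differences m)
    differences-positive m = All.tabulate λ x∈ →
      let i , j , 1≤j , _ , j+i<k , x≡gap = ∈-differences m x∈ in subst (1 ≤_) (sym x≡gap) (gap-positive 1≤j j+i<k)

    differences-unique : ∀ m → Unique (differences m)
    differences-unique zero    = []
    differences-unique (suc m) = Unique.++⁺ block-unique (differences-unique m) disjoint
      where
      block-unique : Unique (block (suc m))
      block-unique = Unique.applyUpTo⁺₁ (λ i → gap i (suc m)) (k ∸ suc m) λ i<i′ i′<k∸j same-gap →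
        <⇒≢ i<i′ (proj₁ (gap-injective (s≤s z≤n) (in-range (<-trans i<i′ i′<k∸j)) (in-range i′<k∸j) same-gap))
      disjoint : ∀ {x} → x ∈ block (suc m) × x ∈ differences m → ⊥
      disjoint (x∈block , x∈rest) =
        let i , i<k∸j , x≡gap = ∈-applyUpTo⁻ (λ i → gap i (suc m)) x∈block
            i′ , j′ , _ , j′≤m , j′+i′<k , x≡gap′ = ∈-differences m x∈rest
        in <⇒≢ (s≤s j′≤m) (sym (proj₂ (gap-injective (s≤s z≤n) (in-range i<k∸j) j′+i′<k (trans (sym x≡gap) x≡gap′))))

    differences-length : ∀ m → m ≤ k → 2 * length (differences m) + m * (m + 1) ≡ 2 * m * k
    differences-length zero    _   = refl
    differences-length (suc m) m<k = begin
      2 * length (block (suc m) ++ differences m) + suc m * (suc m + 1) ≡⟨ cong (λ n → 2 * n + suc m * (suc m + 1)) length-split ⟩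
      2 * (c + L) + suc m * (suc m + 1)                                 ≡⟨ regroup c L m ⟩
      (2 * L + m * (m + 1)) + 2 * (c + suc m)                           ≡⟨ cong (_+ 2 * (c + suc m)) (differences-length m (<⇒≤ m<k)) ⟩
      2 * m * k + 2 * (c + suc m)                                       ≡⟨ cong (λ n → 2 * m * n + 2 * (c + suc m)) c+m+1≡k ⟨
      2 * m * (c + suc m) + 2 * (c + suc m)                             ≡⟨ factor m (c + suc m) ⟩
      2 * suc m * (c + suc m)                                           ≡⟨ cong (2 * suc m *_) c+m+1≡k ⟩
      2 * suc m * k                                                     ∎
      where
      open ≡-Reasoning
      c L : ℕ
      c = k ∸ suc m
      L = length (differences m)
      c+m+1≡k : c + suc m ≡ k
      c+m+1≡k = m∸n+n≡m m<k
      length-split : length (block (suc m) ++ differences m) ≡ c + L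
      length-split = trans (length-++ (block (suc m))) (cong (_+ L) (length-applyUpTo _ c))
      regroup : ∀ c L m → 2 * (c + L) + suc m * (suc m + 1) ≡ (2 * L + m * (m + 1)) + 2 * (c + suc m)
      regroup = solve-∀
      factor : ∀ m n → 2 * m * n + 2 * n ≡ 2 * suc m * n
      factor = solve-∀

    differences-sum : ∀ m → m ≤ k → 2 * sum (differences m) ≤ m * (m + 1) * d
    differences-sum zero    _   = z≤n
    differences-sum (suc m) m<k = begin
      2 * sum (block (suc m) ++ differences m)                 ≡⟨ cong (2 *_) (sum-++ (block (suc m)) (differences m)) ⟩
      2 * (sum (block (suc m)) + sum (differences m))          ≡⟨ *-distribˡ-+ 2 (sum (block (suc m))) _ ⟩
      2 * sum (block (suc m)) + 2 * sum (differences m)        ≤⟨ +-mono-≤ (*-monoʳ-≤ 2 (gaps-sum (suc m) m<k)) (differences-sum m (<⇒≤ m<k)) ⟩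
      2 * (suc m * d) + m * (m + 1) * d                        ≡⟨ factor m d ⟩
      suc m * (suc m + 1) * d                                  ∎
      where
      open ≤-Reasoning
      factor : ∀ m d → 2 * (suc m * d) + m * (m + 1) * d ≡ suc m * (suc m + 1) * d
      factor = solve-∀

    gap-count : ∀ m → m ≤ k → ∃ λ N → 2 * N + m * (m + 1) ≡ 2 * m * k × N * (N + 1) ≤ m * (m + 1) * d
    gap-count m m≤k = length (differences m) , differences-length m m≤k ,
      ≤-trans (distinct-positive-sum (differences m) (differences-unique m) (differences-positive m)) (differences-sum m m≤k)

module Sidon-lists where

  open import Data.Integer.Base as ℤ using (ℤ; +_; ∣_∣)
  import Data.Integer.Properties as ℤ
  open import Data.Integer.Tactic.RingSolver using (solve-∀)
  open import Data.List.Base using (List; []; _∷_; length)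
  open import Data.List.Membership.Propositional using (_∈_)
  open import Data.List.Relation.Binary.Permutation.Propositional using (_↭_; ↭-sym)
  open import Data.List.Relation.Binary.Permutation.Propositional.Properties using (∈-resp-↭; ↭-length)
  open import Data.List.Relation.Unary.All as All using (All)
  open import Data.List.Relation.Unary.AllPairs as AllPairs using (AllPairs; _∷_)
  open import Data.List.Relation.Unary.Any using (here; there)
  open import Data.List.Relation.Unary.Linked.Properties using (Linked⇒AllPairs)
  open import Data.List.Relation.Unary.Unique.Propositional using (Unique)
  open import Data.List.Sort ℤ.≤-decTotalOrder using (sort; sort-↭; sort-↗)
  open import Data.Nat.Base using (ℕ; zero; suc; _+_; _*_; _≤_; _<_; s<s)
  open import Data.Nat.Properties using (<-trans)
  open import Data.Product.Base using (∃; _×_; _,_; proj₁; proj₂)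
  open import Data.Sum.Base as Sum using (_⊎_)
  open import Relation.Binary.PropositionalEquality
  open import Defs using (Sidon)
  open Differences using (unique-↭; module Gaps)

  nth : List ℤ → ℕ → ℤ
  nth []       _       = + 0
  nth (x ∷ xs) zero    = x
  nth (x ∷ xs) (suc i) = nth xs i

  nth-∈ : ∀ xs {i} → i < length xs → nth xs i ∈ xs
  nth-∈ (x ∷ xs) {zero}  _         = here refl
  nth-∈ (x ∷ xs) {suc i} (s<s i<n) = there (nth-∈ xs i<n)

  nth-increasing : ∀ {xs} → AllPairs ℤ._<_ xs → ∀ {i j} → i < j → j < length xs → nth xs i ℤ.< nth xs j
  nth-increasing {x ∷ xs} (x< ∷ _)   {zero}  {suc j} _         (s<s j<n) = All.lookup x< (nth-∈ xs j<n)
  nth-increasing {x ∷ xs} (_ ∷ <xs) {suc i} {suc j} (s<s i<j) (s<s j<n) = nth-increasing <xs i<j j<n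

  module Shifted (A : List ℤ) (lo : ℤ) (d : ℕ) (unique : Unique A) (sidon : Sidon A)
                 (range : All (λ a → lo ℤ.≤ a × a ℤ.≤ lo ℤ.+ + d) A) where

    ys : List ℤ
    ys = sort A

    sorted : ys ↭ A
    sorted = sort-↭ A

    ys-increasing : AllPairs ℤ._<_ ys
    ys-increasing = AllPairs.zipWith (λ (x≤y , x≢y) → ℤ.≤∧≢⇒< x≤y x≢y)
                                     (Linked⇒AllPairs ℤ.≤-trans (sort-↗ A) , unique-↭ (↭-sym sorted) unique)

    member : ∀ {i} → i < length ys → nth ys i ∈ A
    member i<k = ∈-resp-↭ sorted (nth-∈ ys i<k)

    shift : ℤ → ℕ
    shift a = ∣ a ℤ.- lo ∣

    f : ℕ → ℕ
    f i = shift (nth ys i)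

    +f : ∀ {i} → i < length ys → + f i ≡ nth ys i ℤ.- lo
    +f i<k = ℤ.0≤i⇒+∣i∣≡i (ℤ.i≤j⇒0≤j-i (proj₁ (All.lookup range (member i<k))))

    f-increasing : ∀ {i j} → i < j → j < length ys → f i < f j
    f-increasing i<j j<k = ℤ.drop‿+<+ (subst₂ ℤ._<_ (sym (+f (<-trans i<j j<k))) (sym (+f j<k))
                                              (ℤ.+-monoˡ-< (ℤ.- lo) (nth-increasing ys-increasing i<j j<k)))

    f-bounded : ∀ {i} → i < length ys → f i ≤ d
    f-bounded i<k = ℤ.drop‿+≤+ (subst₂ ℤ._≤_ (sym (+f i<k)) (shift-back lo (+ d))
                                          (ℤ.+-monoˡ-≤ (ℤ.- lo) (proj₂ (All.lookup range (member i<k)))))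
      where
      shift-back : ∀ lo d → lo ℤ.+ d ℤ.- lo ≡ d
      shift-back = solve-∀

    same-sum : ∀ {i₁ i₂ i₃ i₄} → i₁ < length ys → i₂ < length ys → i₃ < length ys → i₄ < length ys →
      f i₁ + f i₂ ≡ f i₃ + f i₄ → nth ys i₁ ℤ.+ nth ys i₂ ≡ nth ys i₃ ℤ.+ nth ys i₄
    same-sum {i₁} {i₂} {i₃} {i₄} l₁ l₂ l₃ l₄ eq = begin
      nth ys i₁ ℤ.+ nth ys i₂                                   ≡⟨ unshift (nth ys i₁) (nth ys i₂) lo ⟩
      (nth ys i₁ ℤ.- lo) ℤ.+ (nth ys i₂ ℤ.- lo) ℤ.+ (lo ℤ.+ lo) ≡⟨ cong₂ (λ a b → a ℤ.+ b ℤ.+ (lo ℤ.+ lo)) (+f l₁) (+f l₂) ⟨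
      + f i₁ ℤ.+ + f i₂ ℤ.+ (lo ℤ.+ lo)                         ≡⟨ cong (ℤ._+ (lo ℤ.+ lo)) +-eq ⟩
      + f i₃ ℤ.+ + f i₄ ℤ.+ (lo ℤ.+ lo)                         ≡⟨ cong₂ (λ a b → a ℤ.+ b ℤ.+ (lo ℤ.+ lo)) (+f l₃) (+f l₄) ⟩
      (nth ys i₃ ℤ.- lo) ℤ.+ (nth ys i₄ ℤ.- lo) ℤ.+ (lo ℤ.+ lo) ≡⟨ unshift (nth ys i₃) (nth ys i₄) lo ⟨
      nth ys i₃ ℤ.+ nth ys i₄                                   ∎
      where
      open ≡-Reasoning
      unshift : ∀ a b lo → a ℤ.+ b ≡ (a ℤ.- lo) ℤ.+ (b ℤ.- lo) ℤ.+ (lo ℤ.+ lo)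
      unshift = solve-∀
      +-eq : + f i₁ ℤ.+ + f i₂ ≡ + f i₃ ℤ.+ + f i₄
      +-eq = trans (sym (ℤ.pos-+ (f i₁) (f i₂))) (trans (cong +_ eq) (ℤ.pos-+ (f i₃) (f i₄)))

    f-sidon : ∀ {i₁ i₂ i₃ i₄} → i₁ < length ys → i₂ < length ys → i₃ < length ys → i₄ < length ys →
      f i₁ + f i₂ ≡ f i₃ + f i₄ → (f i₁ ≡ f i₃ × f i₂ ≡ f i₄) ⊎ (f i₁ ≡ f i₄ × f i₂ ≡ f i₃)
    f-sidon l₁ l₂ l₃ l₄ eq =
      Sum.map (λ (p , q) → cong shift p , cong shift q) (λ (p , q) → cong shift p , cong shift q)
              (sidon (member l₁) (member l₂) (member l₃) (member l₄) (same-sum l₁ l₂ l₃ l₄ eq))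

  sidon-gap-count : ∀ (A : List ℤ) lo d → Unique A → Sidon A → All (λ a → lo ℤ.≤ a × a ℤ.≤ lo ℤ.+ + d) A →
    ∀ m → m ≤ length A → ∃ λ N → 2 * N + m * (m + 1) ≡ 2 * m * length A × N * (N + 1) ≤ m * (m + 1) * d
  sidon-gap-count A lo d unique sidon range m m≤k =
    subst (λ k → ∃ λ N → 2 * N + m * (m + 1) ≡ 2 * m * k × N * (N + 1) ≤ m * (m + 1) * d) (↭-length sorted)
          (Gaps.gap-count f (length ys) d f-increasing f-bounded f-sidon m (subst (m ≤_) (sym (↭-length sorted)) m≤k))
    where
    open Shifted A lo d unique sidon range

module Estimates where

  open import Data.Fin.Base using (zero; suc)
  open import Data.Nat.Base using (ℕ; zero; suc; _+_; _*_; _≤_; _<_; s≤s⁻¹)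
  open import Data.Nat.Properties
  open import Data.Nat.Tactic.RingSolver using (solve-∀)
  open import Data.Product.Base using (Σ-syntax; _,_)
  open import Data.Vec.Base using ([]; _∷_)
  open import Relation.Binary.PropositionalEquality
  open import Relation.Nullary.Decidable.Core using (yes; no)
  open import Function.Base using (_∘_)
  open Polynomials
  open Formulas ℕ-arithmetic
  open Elementary using (am-gm-strict; square+1≢4*)
  private
    module E {n} = Formulas (Expr-arithmetic {n})

    v₀ : ∀ {n} → Expr (suc n)
    v₀ = var zero

    v₁ : ∀ {n} → Expr (suc (suc n))
    v₁ = var (suc zero)

    v₂ : ∀ {n} → Expr (suc (suc (suc n)))
    v₂ = var (suc (suc zero))

  part1-by-coefficients : ∀ {n} (r′ e c : Expr n) {_ : Dominated (E.part1-lhs r′ e c) (E.part1-rhs r′ e c)} ρ →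
    part1-lhs (⟦ r′ ⟧ ρ) (⟦ e ⟧ ρ) (⟦ c ⟧ ρ) ≤ part1-rhs (⟦ r′ ⟧ ρ) (⟦ e ⟧ ρ) (⟦ c ⟧ ρ)
  part1-by-coefficients r′ e c {l≤r} = poly-≤ (E.part1-lhs r′ e c) (E.part1-rhs r′ e c) {l≤r}

  part2-by-coefficients : ∀ {n} (r′ e j : Expr n) {_ : Dominated (E.part2-lhs r′ e j) (E.part2-rhs r′ e j)} ρ →
    part2-lhs (⟦ r′ ⟧ ρ) (⟦ e ⟧ ρ) (⟦ j ⟧ ρ) ≤ part2-rhs (⟦ r′ ⟧ ρ) (⟦ e ⟧ ρ) (⟦ j ⟧ ρ)
  part2-by-coefficients r′ e j {l≤r} = poly-≤ (E.part2-lhs r′ e j) (E.part2-rhs r′ e j) {l≤r}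

  T+M≡2rk : ∀ r′ e → let open Square r′ e in T + M ≡ 2 * r * k
  T+M≡2rk r′ e = poly-≡ (E.Square.T v₀ v₁ :+ E.Square.M v₀ v₁)
                        (con 2 :* E.Square.r v₀ v₁ :* E.Square.k v₀ v₁) (r′ ∷ e ∷ [])

  gaps-bound : ∀ r′ e d N → let open Square r′ e in
    2 * N + M ≡ 2 * r * k → N * (N + 1) ≤ M * d → T * (T + 2) ≤ 4 * M * d
  gaps-bound r′ e d N 2N+M≡2rk N[N+1]≤Md = begin
    T * (T + 2)         ≡⟨ cong (λ t → t * (t + 2)) T≡2N ⟩
    2 * N * (2 * N + 2) ≡⟨ double-product N ⟩
    4 * (N * (N + 1))   ≤⟨ *-monoʳ-≤ 4 N[N+1]≤Md ⟩
    4 * (M * d)         ≡⟨ *-assoc 4 M d ⟨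
    4 * M * d           ∎
    where
    open Square r′ e
    open ≤-Reasoning
    T≡2N : T ≡ 2 * N
    T≡2N = +-cancelʳ-≡ M T (2 * N) (trans (T+M≡2rk r′ e) (sym 2N+M≡2rk))
    double-product : ∀ n → 2 * n * (2 * n + 2) ≡ 4 * (n * (n + 1))
    double-product = solve-∀

  -- A covering of {(r′, e) : e ≤ 2r} by linear images of ℕ², ℕ and ℕ⁰ on each of which the
  -- certificate has nonnegative coefficients; the Newton point is c = r for e ≤ r, else r + 1.
  data Part1Region : ℕ → ℕ → Set where
    k≡1 : Part1Region 0 0
    e≡0 : ∀ a → Part1Region (suc a) 0
    e≤r : ∀ a b → Part1Region (a + b) (suc a)
    r<e : ∀ a b → Part1Region (a + b) (suc (suc (a + b) + a))

  part1-region : ∀ r′ e → e ≤ suc r′ + suc r′ → Part1Region r′ e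
  part1-region zero    zero    _ = k≡1
  part1-region (suc a) zero    _ = e≡0 a
  part1-region r′      (suc a) e≤2r with a ≤? r′
  ... | yes a≤r′ with m≤n⇒∃[o]m+o≡n a≤r′
  ...   | b , refl = e≤r a b
  part1-region r′ (suc a) e≤2r | no a≰r′ with m≤n⇒∃[o]m+o≡n (≰⇒> a≰r′)
  ... | g , refl with m≤n⇒∃[o]m+o≡n g≤r′
    where
    g≤r′ : g ≤ r′
    g≤r′ = s≤s⁻¹ (+-cancelˡ-≤ r′ (suc g) (suc r′) (subst (_≤ r′ + suc r′) (sym (+-suc r′ g)) (s≤s⁻¹ e≤2r)))
  ...   | f , refl = r<e g f

  part1-piece : ∀ {r′ e} → Part1Region r′ e → Σ[ c ∈ ℕ ] part1-lhs r′ e c ≤ part1-rhs r′ e c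
  part1-piece k≡1       = 1 , part1-by-coefficients {0} (con 0) (con 0) (con 1) []
  part1-piece (e≡0 a)   = 2 + a , part1-by-coefficients {1} (con 1 :+ v₀) (con 0) (con 2 :+ v₀) (a ∷ [])
  part1-piece (e≤r a b) = 1 + (a + b) , part1-by-coefficients {2} (v₀ :+ v₁) (con 1 :+ v₀) (con 1 :+ (v₀ :+ v₁)) (a ∷ b ∷ [])
  part1-piece (r<e a b) = 2 + (a + b) , part1-by-coefficients {2} (v₀ :+ v₁) (con 2 :+ (v₀ :+ v₁) :+ v₀) (con 2 :+ (v₀ :+ v₁)) (a ∷ b ∷ [])

  -- As for Part1Region; the centre of the Newton step is h/2 = r + j/2, with j = 0, 1, 2 as e grows.
  data Part2Region : ℕ → ℕ → Set where
    2e≤r′    : ∀ a b → Part2Region (2 * a + b) a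
    e≤r′     : ∀ a b → Part2Region (suc a + b + a) (suc a + b)
    2e≤3r′   : ∀ a b → Part2Region (2 * suc b + a) (suc (2 * suc b + a) + b)
    e≤2r′+1  : ∀ a b → Part2Region (a + b + a) (suc (a + b + a) + (a + b))
    2e≡3r′+1 : ∀ a → Part2Region (a + suc a) (suc (a + suc a) + a)
    e≡2r′+2  : ∀ a → Part2Region a (suc a + suc a)

  above-r′ : ∀ r′ b → b ≤ suc r′ → Part2Region r′ (suc r′ + b)
  above-r′ r′ b b≤r with 2 * suc b ≤? r′
  ... | yes 2b+2≤r′ with m≤n⇒∃[o]m+o≡n 2b+2≤r′
  ...   | a , refl = 2e≤3r′ a b
  above-r′ r′ b b≤r | no 2b+2≰r′ with b ≤? r′
  ... | no b≰r′ = subst (λ c → Part2Region r′ (suc r′ + c)) (sym (≤-antisym b≤r (≰⇒> b≰r′))) (e≡2r′+2 r′)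
  ... | yes b≤r′ with m≤n⇒∃[o]m+o≡n b≤r′
  ...   | t , refl with t ≤? b
  ...     | yes t≤b with m≤n⇒∃[o]m+o≡n t≤b
  ...       | u , refl = e≤2r′+1 t u
  above-r′ r′ b b≤r | no 2b+2≰r′ | yes b≤r′ | t , refl | no t≰b =
    subst (λ c → Part2Region (b + c) (suc (b + c) + b)) (sym (≤-antisym t≤1+b (≰⇒> t≰b))) (2e≡3r′+1 b)
    where
    t≤1+b : t ≤ suc b
    t≤1+b = subst (t ≤_) (cong suc (+-identityʳ b)) (+-cancelˡ-≤ b t _ (s≤s⁻¹ (≰⇒> 2b+2≰r′)))

  part2-region : ∀ r′ e → e ≤ suc r′ + suc r′ → Part2Region r′ e
  part2-region r′ e e≤2r with 2 * e ≤? r′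
  ... | yes le with m≤n⇒∃[o]m+o≡n le
  ...   | b , refl = 2e≤r′ e b
  part2-region r′ e e≤2r | no 2e≰r′ with e ≤? r′
  ... | no e≰r′ with m≤n⇒∃[o]m+o≡n (≰⇒> e≰r′)
  ...   | b , refl = above-r′ r′ b (+-cancelˡ-≤ (suc r′) b (suc r′) e≤2r)
  part2-region r′ e e≤2r | no 2e≰r′ | yes le with m≤n⇒∃[o]m+o≡n le
  ... | a , refl with m≤n⇒∃[o]m+o≡n a<e
    where
    a<e : a < e
    a<e = +-cancelˡ-< e a e (subst (e + a <_) (cong (e +_) (+-identityʳ e)) (≰⇒> 2e≰r′))
  ...   | b , refl = e≤r′ a b

  part2-piece : ∀ {r′ e} → Part2Region r′ e → Σ[ j ∈ ℕ ] part2-lhs r′ e j ≤ part2-rhs r′ e j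
  part2-piece (2e≤r′ a b)    = 0 , part2-by-coefficients {2} (con 2 :* v₀ :+ v₁) v₀ (con 0) (a ∷ b ∷ [])
  part2-piece (e≤r′ a b)     = 1 , part2-by-coefficients {2} (con 1 :+ v₀ :+ v₁ :+ v₀) (con 1 :+ v₀ :+ v₁) (con 1) (a ∷ b ∷ [])
  part2-piece (2e≤3r′ a b)   = 1 , part2-by-coefficients {2} r′ (con 1 :+ r′ :+ v₁) (con 1) (a ∷ b ∷ [])
    where
    r′ : Expr 2
    r′ = con 2 :* (con 1 :+ v₁) :+ v₀
  part2-piece (e≤2r′+1 a b)  = 2 , part2-by-coefficients {2} r′ (con 1 :+ r′ :+ (v₀ :+ v₁)) (con 2) (a ∷ b ∷ [])
    where
    r′ : Expr 2
    r′ = v₀ :+ v₁ :+ v₀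
  part2-piece (2e≡3r′+1 a)   = 2 , part2-by-coefficients {1} r′ (con 1 :+ r′ :+ v₀) (con 2) (a ∷ [])
    where
    r′ : Expr 1
    r′ = v₀ :+ (con 1 :+ v₀)
  part2-piece (e≡2r′+2 a)    = 2 , part2-by-coefficients {1} v₀ (con 1 :+ v₀ :+ (con 1 :+ v₀)) (con 2) (a ∷ [])

  part1-estimate : ∀ r′ e d → e ≤ suc r′ + suc r′ → let open Square r′ e in
    T * (T + 2) ≤ 4 * M * d → Σ[ c ∈ ℕ ] (let open Newton k c in lower ≤ d * P + excess)
  part1-estimate r′ e d e≤2r gaps with part1-piece (part1-region r′ e e≤2r)
  ... | c , piece = c , *-cancelˡ-≤ (4 * M) (begin
    4 * M * lower                     ≤⟨ piece ⟩
    T * (T + 2) * P + 4 * M * excess  ≤⟨ +-monoˡ-≤ (4 * M * excess) (*-monoˡ-≤ P gaps) ⟩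
    4 * M * d * P + 4 * M * excess    ≡⟨ factor (4 * M) d P excess ⟩
    4 * M * (d * P + excess)          ∎)
    where
    open Square r′ e
    open Newton k c
    open ≤-Reasoning
    factor : ∀ a b c d → a * b * c + a * d ≡ a * (b * c + d)
    factor = solve-∀

  part2-estimate : ∀ r′ e d → e ≤ suc r′ + suc r′ → let open Square r′ e in
    T * (T + 2) ≤ 4 * M * d → Σ[ j ∈ ℕ ] (let open Witness r′ e j in fourth X ≤ suc d * fourth H)
  part2-estimate r′ e d e≤2r gaps with part2-piece (part2-region r′ e e≤2r)
  ... | j , piece = j , *-cancelˡ-≤ (4 * M) (begin
    4 * M * fourth X                        ≤⟨ piece ⟩
    (4 * M + T * (T + 2)) * fourth H        ≤⟨ *-monoˡ-≤ (fourth H) (+-monoʳ-≤ (4 * M) gaps) ⟩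
    (4 * M + 4 * M * d) * fourth H          ≡⟨ factor (4 * M) d (fourth H) ⟩
    4 * M * (suc d * fourth H)              ∎)
    where
    open Witness r′ e j
    open ≤-Reasoning
    factor : ∀ a b c → (a + a * b) * c ≡ a * (suc b * c)
    factor = solve-∀

  -- This is k < (X/H)² + X/H + ½ with denominators cleared; the gap is 2(h² + 1 − 4k)², and
  -- h² + 1 ≠ 4k because squares are 0 or 1 mod 4.
  witness-above : ∀ r′ e j → let open Witness r′ e j in
    2 * (H * H) * k < 2 * (X * X) + 2 * H * X + H * H
  witness-above r′ e j = +-cancelʳ-< (2 * (4 * a * b)) _ _ (begin-strict
    2 * (H * H) * k + 2 * (4 * a * b)               <⟨ +-monoʳ-< (2 * (H * H) * k) (*-monoʳ-< 2 (am-gm-strict a b a≢b)) ⟩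
    2 * (H * H) * k + 2 * ((a + b) * (a + b))       ≡⟨ identity ⟨
    2 * (X * X) + 2 * H * X + H * H + 2 * (4 * a * b) ∎)
    where
    open Witness r′ e j
    open ≤-Reasoning
    a b : ℕ
    a = 4 * k
    b = h * h + 1
    a≢b : a ≢ b
    a≢b = square+1≢4* h k ∘ sym
    module W = E.Witness {3} v₀ v₁ v₂
    identity : 2 * (X * X) + 2 * H * X + H * H + 2 * (4 * a * b) ≡ 2 * (H * H) * k + 2 * ((a + b) * (a + b))
    identity = poly-≡ (con 2 :* (W.X :* W.X) :+ con 2 :* W.H :* W.X :+ W.H :* W.H :+ con 2 :* (con 4 :* aᴱ :* bᴱ))
                      (con 2 :* (W.H :* W.H) :* W.k :+ con 2 :* ((aᴱ :+ bᴱ) :* (aᴱ :+ bᴱ))) (r′ ∷ e ∷ j ∷ [])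
      where
      aᴱ bᴱ : Expr 3
      aᴱ = con 4 :* W.k
      bᴱ = W.h :* W.h :+ con 1

module Sieve where

  open import Data.Integer.Base as ℤ using (ℤ; +_)
  open import Data.List.Base using (List; []; _∷_; length)
  open import Data.List.Relation.Unary.All using (All)
  open import Data.List.Relation.Unary.Unique.Propositional using (Unique)
  open import Data.Nat.Base using (ℕ; suc; _+_; _*_; _≤_; _<_; z≤n; s≤s)
  open import Data.Nat.Properties using (≤-trans; m≤m+n; m≤m*n)
  open import Data.Product.Base using (Σ-syntax; _×_; _,_)
  open import Relation.Binary.PropositionalEquality using (_≡_; sym; subst)
  open import Defs using (Sidon)
  open Formulas Polynomials.ℕ-arithmetic using (module Square; module Newton; module Witness; fourth)

  sieve : ∀ (A : List ℤ) lo d → 1 ≤ length A → Unique A → Sidon A →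
    All (λ a → lo ℤ.≤ a × a ℤ.≤ lo ℤ.+ + d) A →
    Σ[ r′ ∈ ℕ ] Σ[ e ∈ ℕ ] (length A ≡ Square.k r′ e × e ≤ suc r′ + suc r′ ×
                             (let open Square r′ e in T * (T + 2) ≤ 4 * M * d))
  sieve []         _  _ () _ _ _
  sieve A@(_ ∷ xs) lo d _ unique sidon range with Elementary.square-decomposition (length xs)
  ... | r′ , e , k≡ , e≤2r = r′ , e , k≡ , e≤2r , bound
    where
    r≤k : suc r′ ≤ length A
    r≤k = subst (suc r′ ≤_) (sym k≡) (≤-trans (m≤m*n (suc r′) (suc r′)) (m≤m+n _ e))
    bound : let open Square r′ e in T * (T + 2) ≤ 4 * M * d
    bound = let N , 2N+M≡2rk , N-bound = Sidon-lists.sidon-gap-count A lo d unique sidon range (suc r′) r≤k in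
      Estimates.gaps-bound r′ e d N (subst (λ k → 2 * N + Square.M r′ e ≡ 2 * suc r′ * k) k≡ 2N+M≡2rk) N-bound

  newton-bound : ∀ (A : List ℤ) lo d → 1 ≤ length A → Unique A → Sidon A →
    All (λ a → lo ℤ.≤ a × a ℤ.≤ lo ℤ.+ + d) A →
    Σ[ c ∈ ℕ ] Newton.lower (length A) c ≤ d * Newton.P (length A) c + Newton.excess (length A) c
  newton-bound A lo d 1≤k unique sidon range =
    let r′ , e , k≡ , e≤2r , gaps = sieve A lo d 1≤k unique sidon range
        c , bound = Estimates.part1-estimate r′ e d e≤2r gaps
    in c , subst (λ k → Newton.lower k c ≤ d * Newton.P k c + Newton.excess k c) (sym k≡) bound

  witness-bound : ∀ (A : List ℤ) lo d → 1 ≤ length A → Unique A → Sidon A →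
    All (λ a → lo ℤ.≤ a × a ℤ.≤ lo ℤ.+ + d) A →
    Σ[ X ∈ ℕ ] Σ[ H ∈ ℕ ] (1 ≤ H × fourth X ≤ suc d * fourth H ×
                            2 * (H * H) * length A < 2 * (X * X) + 2 * H * X + H * H)
  witness-bound A lo d 1≤k unique sidon range =
    let r′ , e , k≡ , e≤2r , gaps = sieve A lo d 1≤k unique sidon range
        j , X⁴≤nH⁴ = Estimates.part2-estimate r′ e d e≤2r gaps
        open Witness r′ e j
    in X , H , s≤s z≤n , X⁴≤nH⁴ ,
       subst (λ k → 2 * (H * H) * k < 2 * (X * X) + 2 * H * X + H * H) (sym k≡) (Estimates.witness-above r′ e j)

module Rational-embedding where

  open import Data.Integer.Base as ℤ using (+_)
  import Data.Integer.Properties as ℤ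
  open import Data.Integer.Tactic.RingSolver using (solve-∀)
  open import Data.Nat.Base as ℕ using (ℕ)
  open import Data.Rational.Base using (ℚ; _+_; _*_; _≤_; _<_; toℚᵘ)
  open import Data.Rational.Properties
  import Data.Rational.Unnormalised.Base as ℚᵘ
  import Data.Rational.Unnormalised.Properties as ℚᵘ
  open import Data.Vec.Base using (map)
  open import Data.Vec.Properties using (lookup-map)
  open import Relation.Binary.PropositionalEquality
  open import Defs using (ℕtoℚ)
  open Polynomials
  open Signature using (Arithmetic)

  private
    embed : ℕ → ℚᵘ.ℚᵘ
    embed n = ℚᵘ.mkℚᵘ (+ n) 0

    toℚᵘ-ℕtoℚ : ∀ n → toℚᵘ (ℕtoℚ n) ℚᵘ.≃ embed n
    toℚᵘ-ℕtoℚ n = toℚᵘ-fromℚᵘ (embed n)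

  ℕtoℚ-+ : ∀ m n → ℕtoℚ (m ℕ.+ n) ≡ ℕtoℚ m + ℕtoℚ n
  ℕtoℚ-+ m n = toℚᵘ-injective (begin
    toℚᵘ (ℕtoℚ (m ℕ.+ n))             ≈⟨ toℚᵘ-ℕtoℚ (m ℕ.+ n) ⟩
    embed (m ℕ.+ n)                   ≈⟨ ℚᵘ.*≡* (trans (cong (ℤ._* + 1) (ℤ.pos-+ m n)) (sum-over-1 (+ m) (+ n))) ⟩
    embed m ℚᵘ.+ embed n              ≈⟨ ℚᵘ.+-cong (toℚᵘ-ℕtoℚ m) (toℚᵘ-ℕtoℚ n) ⟨
    toℚᵘ (ℕtoℚ m) ℚᵘ.+ toℚᵘ (ℕtoℚ n)  ≈⟨ toℚᵘ-homo-+ (ℕtoℚ m) (ℕtoℚ n) ⟨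
    toℚᵘ (ℕtoℚ m + ℕtoℚ n)            ∎)
    where
    open ℚᵘ.≃-Reasoning
    sum-over-1 : ∀ x y → (x ℤ.+ y) ℤ.* + 1 ≡ (x ℤ.* + 1 ℤ.+ y ℤ.* + 1) ℤ.* + 1
    sum-over-1 = solve-∀

  ℕtoℚ-* : ∀ m n → ℕtoℚ (m ℕ.* n) ≡ ℕtoℚ m * ℕtoℚ n
  ℕtoℚ-* m n = toℚᵘ-injective (begin
    toℚᵘ (ℕtoℚ (m ℕ.* n))             ≈⟨ toℚᵘ-ℕtoℚ (m ℕ.* n) ⟩
    embed (m ℕ.* n)                   ≈⟨ ℚᵘ.*≡* (cong (ℤ._* + 1) (ℤ.pos-* m n)) ⟩
    embed m ℚᵘ.* embed n              ≈⟨ ℚᵘ.*-cong (toℚᵘ-ℕtoℚ m) (toℚᵘ-ℕtoℚ n) ⟨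
    toℚᵘ (ℕtoℚ m) ℚᵘ.* toℚᵘ (ℕtoℚ n)  ≈⟨ toℚᵘ-homo-* (ℕtoℚ m) (ℕtoℚ n) ⟨
    toℚᵘ (ℕtoℚ m * ℕtoℚ n)            ∎)
    where
    open ℚᵘ.≃-Reasoning

  ℕtoℚ-mono-≤ : ∀ {m n} → m ℕ.≤ n → ℕtoℚ m ≤ ℕtoℚ n
  ℕtoℚ-mono-≤ {m} {n} m≤n = toℚᵘ-cancel-≤ (ℚᵘ.≤-respˡ-≃ (ℚᵘ.≃-sym (toℚᵘ-ℕtoℚ m)) (ℚᵘ.≤-respʳ-≃ (ℚᵘ.≃-sym (toℚᵘ-ℕtoℚ n))
    (ℚᵘ.*≤* (subst₂ ℤ._≤_ (sym (ℤ.*-identityʳ (+ m))) (sym (ℤ.*-identityʳ (+ n))) (ℤ.+≤+ m≤n)))))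

  ℕtoℚ-mono-< : ∀ {m n} → m ℕ.< n → ℕtoℚ m < ℕtoℚ n
  ℕtoℚ-mono-< {m} {n} m<n = toℚᵘ-cancel-< (ℚᵘ.<-respˡ-≃ (ℚᵘ.≃-sym (toℚᵘ-ℕtoℚ m)) (ℚᵘ.<-respʳ-≃ (ℚᵘ.≃-sym (toℚᵘ-ℕtoℚ n))
    (ℚᵘ.*<* (subst₂ ℤ._<_ (sym (ℤ.*-identityʳ (+ m))) (sym (ℤ.*-identityʳ (+ n))) (ℤ.+<+ m<n)))))

  ℚ-arithmetic : Arithmetic ℚ
  ℚ-arithmetic = record { _+_ = _+_ ; _*_ = _*_ ; #_ = ℕtoℚ }

  ℕtoℚ-eval : ∀ {n} (e : Expr n) ρ → ℕtoℚ (⟦ e ⟧ ρ) ≡ eval ℚ-arithmetic e (map ℕtoℚ ρ)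
  ℕtoℚ-eval (var i)  ρ = sym (lookup-map i ℕtoℚ ρ)
  ℕtoℚ-eval (con c)  ρ = refl
  ℕtoℚ-eval (a :+ b) ρ = trans (ℕtoℚ-+ (⟦ a ⟧ ρ) (⟦ b ⟧ ρ)) (cong₂ _+_ (ℕtoℚ-eval a ρ) (ℕtoℚ-eval b ρ))
  ℕtoℚ-eval (a :* b) ρ = trans (ℕtoℚ-* (⟦ a ⟧ ρ) (⟦ b ⟧ ρ)) (cong₂ _*_ (ℕtoℚ-eval a ρ) (ℕtoℚ-eval b ρ))

  cast-≤ : ∀ {n} (l r : Expr n) ρ → ⟦ l ⟧ ρ ℕ.≤ ⟦ r ⟧ ρ → eval ℚ-arithmetic l (map ℕtoℚ ρ) ≤ eval ℚ-arithmetic r (map ℕtoℚ ρ)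
  cast-≤ l r ρ l≤r = subst₂ _≤_ (ℕtoℚ-eval l ρ) (ℕtoℚ-eval r ρ) (ℕtoℚ-mono-≤ l≤r)

  cast-< : ∀ {n} (l r : Expr n) ρ → ⟦ l ⟧ ρ ℕ.< ⟦ r ⟧ ρ → eval ℚ-arithmetic l (map ℕtoℚ ρ) < eval ℚ-arithmetic r (map ℕtoℚ ρ)
  cast-< l r ρ l<r = subst₂ _<_ (ℕtoℚ-eval l ρ) (ℕtoℚ-eval r ρ) (ℕtoℚ-mono-< l<r)

module Rational-bounds where

  open import Data.Fin.Base using (zero; suc)
  open import Data.Nat.Base as ℕ using (ℕ; z≤n)
  import Data.Nat.Properties as ℕ
  open import Data.Product.Base using (∃; _×_; _,_)
  open import Data.Rational.Base using (ℚ; 0ℚ; 1ℚ; ½; _+_; _-_; -_; _*_; 1/_; _≤_; _<_; positive; nonNegative; Positive; NonZero)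
  open import Data.Rational.Properties
  open import Data.Rational.Solver using (module +-*-Solver)
  open import Data.Vec.Base using (Vec; []; _∷_)
  open import Relation.Binary.Definitions using (tri<; tri≈; tri>)
  open import Relation.Binary.PropositionalEquality
  open import Relation.Nullary.Negation.Core using (contradiction)
  open import Defs using (ℕtoℚ)
  open Polynomials using (Expr; var; con) renaming (_:+_ to _⊕_; _:*_ to _⊗_)
  open Rational-embedding
  open Formulas Polynomials.ℕ-arithmetic using (module Newton; fourth)
  open +-*-Solver using (solve; _:+_; _:-_; _:*_; _:=_; con)
  open ≤-Reasoning

  *-nonNeg : ∀ {a b} → 0ℚ ≤ a → 0ℚ ≤ b → 0ℚ ≤ a * b
  *-nonNeg {a} {b} 0≤a 0≤b = subst (_≤ a * b) (*-zeroˡ b) (*-monoʳ-≤-nonNeg b {{nonNegative 0≤b}} 0≤a)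

  ≤⇒0≤- : ∀ {a b} → a ≤ b → 0ℚ ≤ b - a
  ≤⇒0≤- {a} {b} a≤b = subst (_≤ b - a) (+-inverseʳ a) (+-monoˡ-≤ (- a) a≤b)

  0≤-⇒≤ : ∀ {a b} → 0ℚ ≤ b - a → a ≤ b
  0≤-⇒≤ {a} {b} 0≤b-a = subst₂ _≤_ (+-identityˡ a) (cancel b a) (+-monoˡ-≤ a 0≤b-a)
    where
    cancel : ∀ b a → b - a + a ≡ b
    cancel = solve 2 (λ b a → b :- a :+ a := b) refl

  ≤-by-squares : ∀ {a b} → 0ℚ ≤ b → a * a ≤ b * b → a ≤ b
  ≤-by-squares {a} {b} 0≤b a²≤b² with <-cmp a b
  ... | tri< a<b _ _ = <⇒≤ a<b
  ... | tri≈ _ a≡b _ = ≤-reflexive a≡b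
  ... | tri> _ _ b<a = contradiction (<-≤-trans b²<a² a²≤b²) (<-irrefl refl)
    where
    b²<a² : b * b < a * a
    b²<a² = ≤-<-trans (*-monoˡ-≤-nonNeg b {{nonNegative 0≤b}} (<⇒≤ b<a))
                      (*-monoˡ-<-pos a {{positive (≤-<-trans 0≤b b<a)}} b<a)

  newton-≤-sqrt : ∀ {K C P q} → 0ℚ ≤ K → 0ℚ ≤ P → 0ℚ ≤ q → K ≤ q * q →
    ℕtoℚ 4 * K * (C * C) ≤ P * P → ℕtoℚ 2 * C * K ≤ P * q
  newton-≤-sqrt {K} {C} {P} {q} 0≤K 0≤P 0≤q K≤q² am-gm = ≤-by-squares (*-nonNeg 0≤P 0≤q) (begin
    ℕtoℚ 2 * C * K * (ℕtoℚ 2 * C * K) ≡⟨ rearrange C K ⟩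
    K * (ℕtoℚ 4 * K * (C * C))        ≤⟨ *-monoˡ-≤-nonNeg K {{nonNegative 0≤K}} am-gm ⟩
    K * (P * P)                       ≤⟨ *-monoʳ-≤-nonNeg (P * P) {{nonNegative (*-nonNeg 0≤P 0≤P)}} K≤q² ⟩
    q * q * (P * P)                   ≡⟨ regroup q P ⟩
    P * q * (P * q)                   ∎)
    where
    rearrange : ∀ C K → ℕtoℚ 2 * C * K * (ℕtoℚ 2 * C * K) ≡ K * (ℕtoℚ 4 * K * (C * C))
    rearrange = solve 2 (λ C K → con (ℕtoℚ 2) :* C :* K :* (con (ℕtoℚ 2) :* C :* K) := K :* (con (ℕtoℚ 4) :* K :* (C :* C))) refl
    regroup : ∀ q P → q * q * (P * P) ≡ P * q * (P * q)
    regroup = solve 2 (λ q P → q :* q :* (P :* P) := P :* q :* (P :* q)) refl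

  newton-diameter : ∀ {K C D q} → 0ℚ < K + C * C → 1ℚ ≤ ℕtoℚ 2 * K →
    (K * K + K) * (K + C * C) + ℕtoℚ 2 * C * K ≤ D * (K + C * C) + ((K + C * C) + ℕtoℚ 4 * C * K * K) →
    ℕtoℚ 2 * C * K ≤ (K + C * C) * q →
    K * K - ℕtoℚ 2 * K * q + K + q - 1ℚ ≤ D
  newton-diameter {K} {C} {D} {q} 0<P 1≤2K newton 2CK≤Pq =
    0≤-⇒≤ (*-cancelˡ-≤-pos (K + C * C) {{positive 0<P}} (subst₂ _≤_ (sym (*-zeroʳ (K + C * C))) (sym (regroup K C D q))
      (+-mono-≤ (≤⇒0≤- newton) (*-nonNeg (≤⇒0≤- 1≤2K) (≤⇒0≤- 2CK≤Pq)))))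
    where
    regroup : ∀ K C D q → (K + C * C) * (D - (K * K - ℕtoℚ 2 * K * q + K + q - 1ℚ))
      ≡ (D * (K + C * C) + ((K + C * C) + ℕtoℚ 4 * C * K * K) - ((K * K + K) * (K + C * C) + ℕtoℚ 2 * C * K))
        + (ℕtoℚ 2 * K - 1ℚ) * ((K + C * C) * q - ℕtoℚ 2 * C * K)
    regroup = solve 4 (λ K C D q →
      (K :+ C :* C) :* (D :- (K :* K :- con (ℕtoℚ 2) :* K :* q :+ K :+ q :- con 1ℚ))
      := (D :* (K :+ C :* C) :+ ((K :+ C :* C) :+ con (ℕtoℚ 4) :* C :* K :* K)
          :- ((K :* K :+ K) :* (K :+ C :* C) :+ con (ℕtoℚ 2) :* C :* K))
         :+ (con (ℕtoℚ 2) :* K :- con 1ℚ) :* ((K :+ C :* C) :* q :- con (ℕtoℚ 2) :* C :* K)) refl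

  part1-rational : ∀ k c d (q : ℚ) → 1 ℕ.≤ k →
    Newton.lower k c ℕ.≤ d ℕ.* Newton.P k c ℕ.+ Newton.excess k c →
    0ℚ ≤ q → ℕtoℚ k ≤ q * q →
    ℕtoℚ k * ℕtoℚ k - ℕtoℚ 2 * ℕtoℚ k * q + ℕtoℚ k + q - 1ℚ ≤ ℕtoℚ d
  part1-rational k c d q 1≤k lower≤ 0≤q k≤q² =
    newton-diameter {ℕtoℚ k} {ℕtoℚ c} {ℕtoℚ d} {q} 0<P (cast-≤ (con 1) (con 2 ⊗ v₀) ρ (ℕ.≤-trans 1≤k (ℕ.m≤m+n k (k ℕ.+ 0))))
      (cast-≤ N.lower (v₂ ⊗ N.P ⊕ N.excess) ρ lower≤)
      (newton-≤-sqrt {ℕtoℚ k} {ℕtoℚ c} {ℕtoℚ k + ℕtoℚ c * ℕtoℚ c} {q} (cast-≤ (con 0) v₀ ρ z≤n) (<⇒≤ 0<P) 0≤q k≤q²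
         (cast-≤ (con 4 ⊗ v₀ ⊗ (v₁ ⊗ v₁)) (N.P ⊗ N.P) ρ (Elementary.am-gm k (c ℕ.* c))))
    where
    v₀ v₁ v₂ : Expr 3
    v₀ = var zero
    v₁ = var (suc zero)
    v₂ = var (suc (suc zero))
    ρ : Vec ℕ 3
    ρ = k ∷ c ∷ d ∷ []
    module N = Formulas.Newton (Polynomials.Expr-arithmetic {3}) v₀ v₁
    0<P : 0ℚ < ℕtoℚ k + ℕtoℚ c * ℕtoℚ c
    0<P = cast-< (con 0) N.P ρ (ℕ.<-≤-trans 1≤k (ℕ.m≤m+n k (c ℕ.* c)))

  fourth-root-bound : ∀ {q X H N} → 0ℚ < H → q * H ≡ X →
    X * X * X * X ≤ N * (H * H * H * H) → q * q * q * q ≤ N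
  fourth-root-bound {q} {X} {H} {N} 0<H qH≡X X⁴≤NH⁴ = *-cancelʳ-≤-pos (H * H * H * H) {{positive 0<H⁴}} (begin
    q * q * q * q * (H * H * H * H)           ≡⟨ fourth-power q H ⟩
    (q * H) * (q * H) * (q * H) * (q * H)     ≡⟨ cong (λ x → x * x * x * x) qH≡X ⟩
    X * X * X * X                             ≤⟨ X⁴≤NH⁴ ⟩
    N * (H * H * H * H)                       ∎)
    where
    instance
      _ : Positive H
      _ = positive 0<H
    0<H⁴ : 0ℚ < H * H * H * H
    0<H⁴ = positive⁻¹ (H * H * H * H) {{pos*pos⇒pos (H * H * H) {{pos*pos⇒pos (H * H) {{pos*pos⇒pos H H}} H}} H}}
    fourth-power : ∀ q H → q * q * q * q * (H * H * H * H) ≡ (q * H) * (q * H) * (q * H) * (q * H)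
    fourth-power = solve 2 (λ q H → q :* q :* q :* q :* (H :* H :* H :* H) := (q :* H) :* (q :* H) :* (q :* H) :* (q :* H)) refl

  completed-square-bound : ∀ {q X H K} → 0ℚ ≤ H → q * H ≡ X →
    ℕtoℚ 2 * (H * H) * K < ℕtoℚ 2 * (X * X) + ℕtoℚ 2 * H * X + H * H → K < q * q + q + ½
  completed-square-bound {q} {X} {H} {K} 0≤H qH≡X above =
    *-cancelʳ-<-nonNeg (ℕtoℚ 2 * (H * H)) {{nonNegative 0≤2H²}} (begin-strict
      K * (ℕtoℚ 2 * (H * H))                                      ≡⟨ *-comm K _ ⟩
      ℕtoℚ 2 * (H * H) * K                                        <⟨ above ⟩
      ℕtoℚ 2 * (X * X) + ℕtoℚ 2 * H * X + H * H                    ≡⟨ cong (λ x → ℕtoℚ 2 * (x * x) + ℕtoℚ 2 * H * x + H * H) qH≡X ⟨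
      ℕtoℚ 2 * (q * H * (q * H)) + ℕtoℚ 2 * H * (q * H) + H * H    ≡⟨ complete-square q H ⟨
      (q * q + q + ½) * (ℕtoℚ 2 * (H * H))                        ∎)
    where
    0≤2H² : 0ℚ ≤ ℕtoℚ 2 * (H * H)
    0≤2H² = *-nonNeg (ℕtoℚ-mono-≤ {0} {2} z≤n) (*-nonNeg 0≤H 0≤H)
    complete-square : ∀ q H → (q * q + q + ½) * (ℕtoℚ 2 * (H * H)) ≡ ℕtoℚ 2 * (q * H * (q * H)) + ℕtoℚ 2 * H * (q * H) + H * H
    complete-square = solve 2 (λ q H → (q :* q :+ q :+ con ½) :* (con (ℕtoℚ 2) :* (H :* H))
                                        := con (ℕtoℚ 2) :* (q :* H :* (q :* H)) :+ con (ℕtoℚ 2) :* H :* (q :* H) :+ H :* H) refl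

  part2-rational : ∀ k n X H → 1 ℕ.≤ H → fourth X ℕ.≤ n ℕ.* fourth H →
    2 ℕ.* (H ℕ.* H) ℕ.* k ℕ.< 2 ℕ.* (X ℕ.* X) ℕ.+ 2 ℕ.* H ℕ.* X ℕ.+ H ℕ.* H →
    ∃ λ (q : ℚ) → 0ℚ ≤ q × q * q * q * q ≤ ℕtoℚ n × ℕtoℚ k < q * q + q + ½
  part2-rational k n X H 1≤H X⁴≤nH⁴ above =
    q , 0≤q ,
    fourth-root-bound {q} {ℕtoℚ X} {ℕtoℚ H} {ℕtoℚ n} 0<H qH≡X (cast-≤ (v₂ ⊗ v₂ ⊗ v₂ ⊗ v₂) (v₁ ⊗ (v₃ ⊗ v₃ ⊗ v₃ ⊗ v₃)) ρ X⁴≤nH⁴) ,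
    completed-square-bound {q} {ℕtoℚ X} {ℕtoℚ H} {ℕtoℚ k} (<⇒≤ 0<H) qH≡X
      (cast-< (con 2 ⊗ (v₃ ⊗ v₃) ⊗ v₀) (con 2 ⊗ (v₂ ⊗ v₂) ⊕ con 2 ⊗ v₃ ⊗ v₂ ⊕ v₃ ⊗ v₃) ρ above)
    where
    v₀ v₁ v₂ v₃ : Expr 4
    v₀ = var zero
    v₁ = var (suc zero)
    v₂ = var (suc (suc zero))
    v₃ = var (suc (suc (suc zero)))
    ρ : Vec ℕ 4
    ρ = k ∷ n ∷ X ∷ H ∷ []
    0<H : 0ℚ < ℕtoℚ H
    0<H = cast-< (con 0) v₃ ρ 1≤H
    instance
      _ : NonZero (ℕtoℚ H)
      _ = pos⇒nonZero (ℕtoℚ H) {{positive 0<H}}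
    q : ℚ
    q = ℕtoℚ X * 1/ ℕtoℚ H
    qH≡X : q * ℕtoℚ H ≡ ℕtoℚ X
    qH≡X = trans (*-assoc (ℕtoℚ X) _ (ℕtoℚ H)) (trans (cong (ℕtoℚ X *_) (*-inverseˡ (ℕtoℚ H))) (*-identityʳ (ℕtoℚ X)))
    0≤q : 0ℚ ≤ q
    0≤q = *-cancelʳ-≤-pos (ℕtoℚ H) {{positive 0<H}} (subst₂ _≤_ (sym (*-zeroˡ (ℕtoℚ H))) (sym qH≡X) (cast-≤ (con 0) v₂ ρ z≤n))

module Diameter where

  open import Data.Integer.Base using (ℤ; +_; ∣_∣; _≤_; _+_; _-_; _⊔_; _⊓_)
  open import Data.Integer.Properties using (≤-refl; ≤-trans; i≤i⊔j; i≤j⊔i; i⊓j≤i; i⊓j≤j; 0≤i⇒+∣i∣≡i; i≤j⇒0≤j-i)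
  open import Data.Integer.Tactic.RingSolver using (solve-∀)
  open import Data.List.Base using (List; []; _∷_; foldr)
  open import Data.List.Membership.Propositional using (_∈_)
  open import Data.List.Relation.Unary.All using (All; tabulate)
  open import Data.List.Relation.Unary.Any using (here; there)
  open import Data.Product.Base using (∃₂; _×_; _,_)
  open import Relation.Binary.PropositionalEquality
  open import Defs using (diam)

  ≤-maximum : ∀ x xs {a} → a ∈ x ∷ xs → a ≤ foldr _⊔_ x xs
  ≤-maximum x []       (here refl)         = ≤-refl
  ≤-maximum x (y ∷ ys) (here refl)         = ≤-trans (≤-maximum x ys (here refl)) (i≤j⊔i y _)
  ≤-maximum x (y ∷ ys) (there (here refl)) = i≤i⊔j y _
  ≤-maximum x (y ∷ ys) (there (there a∈))  = ≤-trans (≤-maximum x ys (there a∈)) (i≤j⊔i y _)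

  minimum-≤ : ∀ x xs {a} → a ∈ x ∷ xs → foldr _⊓_ x xs ≤ a
  minimum-≤ x []       (here refl)         = ≤-refl
  minimum-≤ x (y ∷ ys) (here refl)         = ≤-trans (i⊓j≤j y _) (minimum-≤ x ys (here refl))
  minimum-≤ x (y ∷ ys) (there (here refl)) = i⊓j≤i y _
  minimum-≤ x (y ∷ ys) (there (there a∈))  = ≤-trans (i⊓j≤j y _) (minimum-≤ x ys (there a∈))

  diam-range : ∀ x xs → ∃₂ λ lo d → + d ≡ diam (x ∷ xs) × All (λ a → lo ≤ a × a ≤ lo + + d) (x ∷ xs)
  diam-range x xs = lo , ∣ hi - lo ∣ , +d≡hi-lo ,
    tabulate λ a∈ → minimum-≤ x xs a∈ , subst (_ ≤_) (sym lo+d≡hi) (≤-maximum x xs a∈)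
    where
    hi lo : ℤ
    hi = foldr _⊔_ x xs
    lo = foldr _⊓_ x xs
    +d≡hi-lo : + ∣ hi - lo ∣ ≡ hi - lo
    +d≡hi-lo = 0≤i⇒+∣i∣≡i (i≤j⇒0≤j-i (≤-trans (minimum-≤ x xs (here refl)) (≤-maximum x xs (here refl))))
    cancel : ∀ lo hi → lo + (hi - lo) ≡ hi
    cancel = solve-∀
    lo+d≡hi : lo + + ∣ hi - lo ∣ ≡ hi
    lo+d≡hi = trans (cong (λ δ → lo + δ) +d≡hi-lo) (cancel lo hi)

open import Defs
open import Data.Nat using (ℕ; _≥_)
open import Data.Integer using (ℤ; +_)
open import Data.Rational using (ℚ; ½; 0ℚ; 1ℚ; _+_; _-_; _*_; _≤_; _<_)
open import Data.List using (List; length)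
open import Data.List.Relation.Unary.All using (All)
open import Data.List.Relation.Unary.Unique.Propositional using (Unique)
open import Data.Product using (_×_; ∃)
open import Relation.Binary.PropositionalEquality using (_≡_)

open import Data.List.Base using ([]; _∷_)
open import Data.Nat.Base using (suc; z≤n; s≤s)
open import Data.Product using (_,_)
open import Data.Rational.Properties using (≤-refl; positive⁻¹)
open import Relation.Binary.PropositionalEquality using (refl; cong; subst)

diameter-lower-bound : ∀ (k : ℕ) → k ≥ 1 → (A : List ℤ) → Unique A → length A ≡ k → Sidon A →
  ∀ (q : ℚ) → 0ℚ ≤ q → ℕtoℚ k ≤ q * q →
  ℕtoℚ k * ℕtoℚ k - ℕtoℚ 2 * ℕtoℚ k * q + ℕtoℚ k + q - 1ℚ ≤ toℚ (diam A)
diameter-lower-bound _ () [] _ refl _ _ _ _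
diameter-lower-bound _ 1≤k A@(x ∷ xs) unique refl sidon q 0≤q k≤q² =
  let lo , d , d≡diam , range = Diameter.diam-range x xs
      c , newton = Sieve.newton-bound A lo d 1≤k unique sidon range
  in subst (target ≤_) (cong toℚ d≡diam) (Rational-bounds.part1-rational (length A) c d q 1≤k newton 0≤q k≤q²)
  where
  target : ℚ
  target = ℕtoℚ (length A) * ℕtoℚ (length A) - ℕtoℚ 2 * ℕtoℚ (length A) * q + ℕtoℚ (length A) + q - 1ℚ

size-upper-bound : ∀ (n : ℕ) → n ≥ 1 → (A : List ℤ) → Unique A →
  All (λ a → (+ 1 Data.Integer.≤ a) × (a Data.Integer.≤ + n)) A → Sidon A →
  ∃ λ (q : ℚ) → 0ℚ ≤ q × q * q * q * q ≤ ℕtoℚ n × ℕtoℚ (length A) < q * q + q + ½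
size-upper-bound n _ [] _ _ _ = 0ℚ , ≤-refl , Rational-embedding.ℕtoℚ-mono-≤ {0} {n} z≤n , positive⁻¹ ½
size-upper-bound (suc d) _ A@(_ ∷ _) unique range sidon =
  let X , H , 1≤H , X⁴≤nH⁴ , above = Sieve.witness-bound A (+ 1) d (s≤s z≤n) unique sidon range
  in Rational-bounds.part2-rational (length A) (suc d) X H 1≤H X⁴≤nH⁴ above

theorem3 : (∀ (k : ℕ) → k ≥ 1 → (A : List ℤ) → Unique A → length A ≡ k → Sidon A →
    ∀ (q : ℚ) → 0ℚ ≤ q → ℕtoℚ k ≤ q * q →
    ℕtoℚ k * ℕtoℚ k - ℕtoℚ 2 * ℕtoℚ k * q + ℕtoℚ k + q - 1ℚ ≤ toℚ (diam A))
    ×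
    (∀ (n : ℕ) → n ≥ 1 → (A : List ℤ) → Unique A →
    All (λ a → (+ 1 Data.Integer.≤ a) × (a Data.Integer.≤ + n)) A → Sidon A →
    ∃ λ (q : ℚ) → 0ℚ ≤ q × q * q * q * q ≤ ℕtoℚ n ×
    ℕtoℚ (length A) < q * q + q + ½)
theorem3 = diameter-lower-bound , size-upper-bound
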